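{- Let $\mathit{Sign}$ be a category endowed with an inclusion system $(\mathcal{I},\mathcal{E})$, having pullbacks of semi-inclusive cospans, and such that abstract surjections are stable under semi-inclusive pullbacks. Then the following is an inclusion system in $p\mathit{Sign}$: the abstract inclusions are the arrows $[i]$ with $i$ an abstract inclusion of $\mathit{Sign}$, and the abstract surjections are the partial morphisms $\varphi$ such that $\varphi^0$ is an abstract surjection of $\mathit{Sign}$.
   Context: Composition is diagrammatic ($f;g$ = first $f$ then $g$). An inclusion system for a category $\mathbf{C}$ is a pair $(\mathcal{I},\mathcal{E})$ of broad subcategories such that $\mathcal{I}$ is a partial order (arrows: abstract inclusions, written $A\subseteq B$) and every arrow $f$ factors uniquely as $f=e_f;i_f$ with $e_f\in\mathcal{E}$ (abstract surjections) and $i_f\in\mathcal{I}$. A cospan $f_1\colon A_1\to A$, $f_2\colon A_2\to A$ is semi-inclusive if one of $f_1,f_2$ is an abstract inclusion. With pullbacks of semi-inclusive cospans, for any $f\colon A\to B$ and abstract inclusion $B'\subseteq B$ there is a unique pullback square of $f$ and $B'\subseteq B$ whose side towards $A$ is an abstract inclusion $A'\subseteq A$ (the inclusive pullback), with other side $f'\colon A'\to B'$. Abstract surjections are stable under semi-inclusive pullbacks if in every such inclusive pullback square, $f$ being an abstract surjection implies $f'$ is an abstract surjection. A partial $\mathit{Sign}$-morphism $\varphi\colon\Sigma\rightharpoonup\Sigma'$ is a $\mathit{Sign}$-morphism $\varphi^0\colon\mathrm{dom}\,\varphi\to\Sigma'$ with $\mathrm{dom}\,\varphi\subseteq\Sigma$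 an abstract inclusion. Composition of $\varphi\colon\Sigma\rightharpoonup\Sigma'$, $\varphi'\colon\Sigma'\rightharpoonup\Sigma''$: take the inclusive pullback of $\varphi^0$ along $\mathrm{dom}\,\varphi'\subseteq\Sigma'$, with vertex $D\subseteq\mathrm{dom}\,\varphi$ and side $(\varphi^0)'\colon D\to\mathrm{dom}\,\varphi'$; set $\mathrm{dom}(\varphi;\varphi')=D$ and $(\varphi;\varphi')^0=(\varphi^0)';\varphi'^0$. $p\mathit{Sign}$ is the category with the objects of $\mathit{Sign}$, partial $\mathit{Sign}$-morphisms as arrows, this composition, and identities $[1_\Sigma]$, where for $\chi\colon\Sigma\to\Sigma'$ in $\mathit{Sign}$, $[\chi]$ is the partial morphism with $\mathrm{dom}[\chi]=\Sigma$ and $[\chi]^0=\chi$. -}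

module Defs where

open import Level using (Level; _⊔_) renaming (suc to lsuc)
open import Relation.Binary.PropositionalEquality using (_≡_; subst)
open import Relation.Binary using (IsEquivalence)
open import Data.Product using (Σ; _×_; _,_)
open import Data.Sum using (_⊎_)

-- Categories with a setoid of arrows; composition is diagrammatic: f ⨾ g = first f then g.
record Category (o ℓ e : Level) : Set (lsuc (o ⊔ ℓ ⊔ e)) where
  infixr 9 _⨾_
  infix 4 _≈_
  field
    Obj : Set o
    Hom : Obj → Obj → Set ℓ
    _≈_ : ∀ {A B} → Hom A B → Hom A B → Set e
    id : ∀ {A} → Hom A A
    _⨾_ : ∀ {A B C} → Hom A B → Hom B C → Hom A C
    ≈-equiv : ∀ {A B} → IsEquivalence (_≈_ {A} {B})
    identityˡ : ∀ {A B} {f : Hom A B} → id ⨾ f ≈ f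
    identityʳ : ∀ {A B} {f : Hom A B} → f ⨾ id ≈ f
    assoc : ∀ {A B C D} {f : Hom A B} {g : Hom B C} {h : Hom C D} →
            (f ⨾ g) ⨾ h ≈ f ⨾ (g ⨾ h)
    ⨾-resp-≈ : ∀ {A B C} {f f' : Hom A B} {g g' : Hom B C} →
               f ≈ f' → g ≈ g' → f ⨾ g ≈ f' ⨾ g'

module _ {o ℓ e : Level} {Obj : Set o} (Hom : Obj → Obj → Set ℓ)
         (_≈_ : ∀ {A B} → Hom A B → Hom A B → Set e)
         (id : ∀ {A} → Hom A A)
         (_⨾_ : ∀ {A B C} → Hom A B → Hom B C → Hom A C) where

  record IsInclusionSystem {i j : Level}
         (I : ∀ {A B} → Hom A B → Set i) (E : ∀ {A B} → Hom A B → Set j)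
         : Set (o ⊔ ℓ ⊔ e ⊔ i ⊔ j) where
    field
      I-resp : ∀ {A B} {f g : Hom A B} → f ≈ g → I f → I g
      E-resp : ∀ {A B} {f g : Hom A B} → f ≈ g → E f → E g
      I-id : ∀ {A} → I (id {A})
      I-comp : ∀ {A B C} {f : Hom A B} {g : Hom B C} → I f → I g → I (f ⨾ g)
      E-id : ∀ {A} → E (id {A})
      E-comp : ∀ {A B C} {f : Hom A B} {g : Hom B C} → E f → E g → E (f ⨾ g)
      -- I is a partial order (thin and antisymmetric; reflexive/transitive by the above)
      I-thin : ∀ {A B} {f g : Hom A B} → I f → I g → f ≈ g
      I-antisym : ∀ {A B} {f : Hom A B} {g : Hom B A} → I f → I g → A ≡ B
      factor : ∀ {A B} (f : Hom A B) →
               Σ Obj λ C → Σ (Hom A C) λ e' → Σ (Hom C B) λ i' →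
                 E e' × I i' × (e' ⨾ i') ≈ f
      unique : ∀ {A B C C'} {f : Hom A B}
               {e₁ : Hom A C} {i₁ : Hom C B} {e₂ : Hom A C'} {i₂ : Hom C' B} →
               E e₁ → I i₁ → (e₁ ⨾ i₁) ≈ f →
               E e₂ → I i₂ → (e₂ ⨾ i₂) ≈ f →
               Σ (C ≡ C') λ p →
                 (subst (Hom A) p e₁ ≈ e₂) × (subst (λ X → Hom X B) p i₁ ≈ i₂)

module _ {o ℓ e : Level} (C : Category o ℓ e) where
  open Category C

  record IsPullback {A₁ A₂ A P : Obj} (f₁ : Hom A₁ A) (f₂ : Hom A₂ A)
         (p₁ : Hom P A₁) (p₂ : Hom P A₂) : Set (o ⊔ ℓ ⊔ e) where
    field
      commute : p₁ ⨾ f₁ ≈ p₂ ⨾ f₂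
      universal : ∀ {Q} (q₁ : Hom Q A₁) (q₂ : Hom Q A₂) → q₁ ⨾ f₁ ≈ q₂ ⨾ f₂ →
                  Σ (Hom Q P) λ u → (u ⨾ p₁ ≈ q₁) × (u ⨾ p₂ ≈ q₂)
      unique-med : ∀ {Q} {q₁ : Hom Q A₁} {q₂ : Hom Q A₂} (u v : Hom Q P) →
                   u ⨾ p₁ ≈ q₁ → u ⨾ p₂ ≈ q₂ → v ⨾ p₁ ≈ q₁ → v ⨾ p₂ ≈ q₂ → u ≈ v

  module _ {i : Level} (I : ∀ {A B} → Hom A B → Set i) where

    HasSemiInclusivePullbacks : Set (o ⊔ ℓ ⊔ e ⊔ i)
    HasSemiInclusivePullbacks =
      ∀ {A₁ A₂ A} (f₁ : Hom A₁ A) (f₂ : Hom A₂ A) → I f₁ ⊎ I f₂ →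
      Σ Obj λ P → Σ (Hom P A₁) λ p₁ → Σ (Hom P A₂) λ p₂ → IsPullback f₁ f₂ p₁ p₂

    InclusivePullbacks : Set (o ⊔ ℓ ⊔ e ⊔ i)
    InclusivePullbacks =
      ∀ {A B B'} (f : Hom A B) (j : Hom B' B) → I j →
      Σ Obj λ A' → Σ (Hom A' A) λ i' → Σ (Hom A' B') λ f' →
        I i' × IsPullback f j i' f'

    SurjectionsStable : {k : Level} (E : ∀ {A B} → Hom A B → Set k) → Set (o ⊔ ℓ ⊔ e ⊔ i ⊔ k)
    SurjectionsStable E =
      ∀ {A B B' A'} (f : Hom A B) (j : Hom B' B) (i' : Hom A' A) (f' : Hom A' B') →
      I j → I i' → IsPullback f j i' f' → E f → E f'

  module Partial {i j : Level} (I : ∀ {A B} → Hom A B → Set i)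
                 (E : ∀ {A B} → Hom A B → Set j)
                 (IS : IsInclusionSystem Hom _≈_ id _⨾_ I E)
                 (incPB : InclusivePullbacks I) where
    open IsInclusionSystem IS using (I-id; I-comp)

    record PHom (Σ₁ Σ₂ : Obj) : Set (o ⊔ ℓ ⊔ i) where
      constructor pmor
      field
        dom : Obj
        domIncl : Hom dom Σ₁
        domIncl-I : I domIncl
        φ⁰ : Hom dom Σ₂
    open PHom public

    -- equality of partial morphisms: same domain, same φ⁰
    -- (the inclusion dom φ ⊆ Σ is then determined, I being a partial order)
    _≈ₚ_ : ∀ {Σ₁ Σ₂} → PHom Σ₁ Σ₂ → PHom Σ₁ Σ₂ → Set (o ⊔ e)
    _≈ₚ_ {Σ₁} {Σ₂} φ ψ = Σ (dom φ ≡ dom ψ) λ p → subst (λ X → Hom X Σ₂) p (φ⁰ φ) ≈ φ⁰ ψ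

    ⟦_⟧ : ∀ {Σ₁ Σ₂} → Hom Σ₁ Σ₂ → PHom Σ₁ Σ₂
    ⟦ χ ⟧ = pmor _ id I-id χ

    idₚ : ∀ {Σ₁} → PHom Σ₁ Σ₁
    idₚ = ⟦ id ⟧

    _⨾ₚ_ : ∀ {Σ₁ Σ₂ Σ₃} → PHom Σ₁ Σ₂ → PHom Σ₂ Σ₃ → PHom Σ₁ Σ₃
    φ ⨾ₚ φ' with incPB (φ⁰ φ) (domIncl φ') (domIncl-I φ')
    ... | D , d , f' , Id , _ = pmor D (d ⨾ domIncl φ) (I-comp Id (domIncl-I φ)) (f' ⨾ φ⁰ φ')

    pI : ∀ {Σ₁ Σ₂} → PHom Σ₁ Σ₂ → Set (o ⊔ ℓ ⊔ e ⊔ i)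
    pI {Σ₁} {Σ₂} φ = Σ (Hom Σ₁ Σ₂) λ ι → I ι × (φ ≈ₚ ⟦ ι ⟧)

    pE : ∀ {Σ₁ Σ₂} → PHom Σ₁ Σ₂ → Set j
    pE φ = E (φ⁰ φ)

-- Everything rests on
-- one observation: an abstract inclusion admitting a section is an identity, so the
-- inclusive pullback along dom[χ] = Σ changes nothing and φ ⨾ₚ [χ] has underlying
-- morphism φ⁰ ⨾ χ.  Factorisations and their uniqueness then transfer from Sign, and
-- surjections compose in pSign because they are stable under inclusive pullbacks.
module Submission where

open import Level using (Level; _⊔_)
open import Data.Product using (Σ; _×_; _,_; proj₁; proj₂)
open import Relation.Binary using (Setoid)
open import Relation.Binary.PropositionalEquality using (_≡_; refl; subst)
import Relation.Binary.Reasoning.Setoid as SetoidReasoning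
open import Defs

module _ {o ℓ e : Level} (Sign : Category o ℓ e) where
  open Category Sign

  hom-setoid : Obj → Obj → Setoid ℓ e
  hom-setoid A B = record { Carrier = Hom A B ; _≈_ = _≈_ ; isEquivalence = ≈-equiv }

  module ≈ {A B : Obj} = Setoid (hom-setoid A B)

  infix 4 _≅_
  _≅_ : ∀ {X Y B} → Hom X B → Hom Y B → Set (o ⊔ e)
  _≅_ {X} {Y} {B} f g = Σ (X ≡ Y) λ p → subst (λ Z → Hom Z B) p f ≈ g

  ≅-refl : ∀ {X B} {f : Hom X B} → f ≅ f
  ≅-refl = refl , ≈.refl

  ≅-sym : ∀ {X Y B} {f : Hom X B} {g : Hom Y B} → f ≅ g → g ≅ f
  ≅-sym (refl , f≈g) = refl , ≈.sym f≈g

  ≅-trans : ∀ {X Y Z B} {f : Hom X B} {g : Hom Y B} {h : Hom Z B} → f ≅ g → g ≅ h → f ≅ h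
  ≅-trans (refl , f≈g) (refl , g≈h) = refl , ≈.trans f≈g g≈h

  ≈⇒≅ : ∀ {X B} {f g : Hom X B} → f ≈ g → f ≅ g
  ≈⇒≅ f≈g = refl , f≈g

  ≅-⨾ : ∀ {X Y B C} {f : Hom X B} {g : Hom Y B} {h h' : Hom B C} →
        f ≅ g → h ≈ h' → f ⨾ h ≅ g ⨾ h'
  ≅-⨾ (refl , f≈g) h≈h' = refl , ⨾-resp-≈ f≈g h≈h'

  module _ {i j : Level} {I : ∀ {A B} → Hom A B → Set i} {E : ∀ {A B} → Hom A B → Set j}
           (IS : IsInclusionSystem Hom _≈_ id _⨾_ I E) where
    open IsInclusionSystem IS

    I-endo≈id : ∀ {A} {ι : Hom A A} → I ι → ι ≈ id
    I-endo≈id Iι = I-thin Iι I-id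

    ≅-E : ∀ {X Y B} {f : Hom X B} {g : Hom Y B} → f ≅ g → E f → E g
    ≅-E (refl , f≈g) = E-resp f≈g

    -- Factor the section s as ε ⨾ κ: then ε ⨾ (κ ⨾ ι) is an (E, I)-factorisation of id,
    -- so κ : A → A' is an inclusion and antisymmetry applies.
    I-retraction⇒≡ : ∀ {A' A} {ι : Hom A' A} {s : Hom A A'} → I ι → s ⨾ ι ≈ id → A' ≡ A
    I-retraction⇒≡ {ι = ι} {s} Iι sι≈id with factor s
    ... | _ , ε , κ , Eε , Iκ , εκ≈s
      with unique Eε (I-comp Iκ Iι) (≈.trans (≈.sym assoc) (≈.trans (⨾-resp-≈ εκ≈s ≈.refl) sι≈id))
                  E-id I-id identityˡ
    ... | refl , _ = I-antisym Iι Iκ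

    inclusivePullback-along-I-endo-vertex≡ : ∀ {A A' B} {f : Hom A B} {ι : Hom B B}
      {κ : Hom A' A} {f' : Hom A' B} → I ι → I κ → IsPullback Sign f ι κ f' → A' ≡ A
    inclusivePullback-along-I-endo-vertex≡ {f = f} {ι} Iι Iκ pb =
      I-retraction⇒≡ Iκ (proj₁ (proj₂ (universal id f square)))
      where
      open IsPullback pb
      open SetoidReasoning (hom-setoid _ _)
      square : id ⨾ f ≈ f ⨾ ι
      square = begin
        id ⨾ f  ≈⟨ identityˡ ⟩
        f       ≈⟨ identityʳ ⟨
        f ⨾ id  ≈⟨ ⨾-resp-≈ ≈.refl (I-endo≈id Iι) ⟨
        f ⨾ ι   ∎

    inclusivePullback-along-I-endo : ∀ {A A' B} {f : Hom A B} {ι : Hom B B} {κ : Hom A' A}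
      {f' : Hom A' B} → I ι → I κ → IsPullback Sign f ι κ f' → f' ≅ f
    inclusivePullback-along-I-endo {f = f} {ι} {κ} {f'} Iι Iκ pb
      with inclusivePullback-along-I-endo-vertex≡ Iι Iκ pb
    ... | refl = refl , (begin
        f'      ≈⟨ identityʳ ⟨
        f' ⨾ id ≈⟨ ⨾-resp-≈ ≈.refl (I-endo≈id Iι) ⟨
        f' ⨾ ι  ≈⟨ commute ⟨
        κ ⨾ f   ≈⟨ ⨾-resp-≈ (I-endo≈id Iκ) ≈.refl ⟩
        id ⨾ f  ≈⟨ identityˡ ⟩
        f       ∎)
      where
      open IsPullback pb
      open SetoidReasoning (hom-setoid _ _)

    factorisation-unique-≅ : ∀ {X₁ X₂ C C' B} {ε₁ : Hom X₁ C} {ι₁ : Hom C B}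
      {ε₂ : Hom X₂ C'} {ι₂ : Hom C' B} → E ε₁ → I ι₁ → E ε₂ → I ι₂ → ε₁ ⨾ ι₁ ≅ ε₂ ⨾ ι₂ →
      Σ (C ≡ C') λ p → (subst (Hom X₁) p ε₁ ≅ ε₂) × (subst (λ Z → Hom Z B) p ι₁ ≈ ι₂)
    factorisation-unique-≅ Eε₁ Iι₁ Eε₂ Iι₂ (refl , ει₁≈ει₂)
      with unique Eε₁ Iι₁ ει₁≈ει₂ Eε₂ Iι₂ ≈.refl
    ... | refl , ε₁≈ε₂ , ι₁≈ι₂ = refl , ≈⇒≅ ε₁≈ε₂ , ι₁≈ι₂

    module _ (incPB : InclusivePullbacks Sign I) where
      open Partial Sign I E IS incPB

      ⨾ₚ-total : ∀ {A B C} (φ : PHom A B) {ι : Hom B B} (Iι : I ι) (χ : Hom B C) →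
                 φ⁰ (φ ⨾ₚ pmor B ι Iι χ) ≅ φ⁰ φ ⨾ χ
      ⨾ₚ-total φ Iι χ with incPB (φ⁰ φ) _ Iι
      ... | _ , _ , _ , Iκ , pb = ≅-⨾ (inclusivePullback-along-I-endo Iι Iκ pb) ≈.refl

      ⨾ₚ-pI : ∀ {A B C} (φ : PHom A B) {ψ : PHom B C} (Iψ : pI ψ) → φ⁰ (φ ⨾ₚ ψ) ≅ φ⁰ φ ⨾ proj₁ Iψ
      ⨾ₚ-pI φ {pmor _ ι Iι χ} (_ , _ , refl , χ≈ι) = ≅-trans (⨾ₚ-total φ Iι χ) (≅-⨾ ≅-refl χ≈ι)

      pI-comp : ∀ {A B C} {φ : PHom A B} {ψ : PHom B C} → pI φ → pI ψ → pI (φ ⨾ₚ ψ)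
      pI-comp {φ = φ} (ι , Iι , φ≅ι) Iψ@(κ , Iκ , _) =
        ι ⨾ κ , I-comp Iι Iκ , ≅-trans (⨾ₚ-pI φ Iψ) (≅-⨾ φ≅ι ≈.refl)

      module _ (stable : SurjectionsStable Sign I E) where

        pE-comp : ∀ {A B C} {φ : PHom A B} {ψ : PHom B C} → pE φ → pE ψ → pE (φ ⨾ₚ ψ)
        pE-comp {φ = φ} {ψ} Eφ Eψ with incPB (φ⁰ φ) (domIncl ψ) (domIncl-I ψ)
        ... | _ , _ , _ , Iκ , pb = E-comp (stable _ _ _ _ (domIncl-I ψ) Iκ pb Eφ) Eψ

      pfactor : ∀ {A B} (φ : PHom A B) →
                Σ Obj λ C → Σ (PHom A C) λ ε → Σ (PHom C B) λ ι →
                  pE ε × pI ι × (ε ⨾ₚ ι) ≈ₚ φ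
      pfactor (pmor D d Id φ⁰) with factor φ⁰
      ... | C , ε , ι , Eε , Iι , ει≈φ⁰ =
        C , pmor D d Id ε , ⟦ ι ⟧ , Eε , Iι′ ,
        ≅-trans (⨾ₚ-pI (pmor D d Id ε) Iι′) (≈⇒≅ ει≈φ⁰)
        where
        Iι′ : pI ⟦ ι ⟧
        Iι′ = ι , Iι , ≅-refl

      punique : ∀ {A B C C'} {φ : PHom A B}
                {ε₁ : PHom A C} {ι₁ : PHom C B} {ε₂ : PHom A C'} {ι₂ : PHom C' B} →
                pE ε₁ → pI ι₁ → (ε₁ ⨾ₚ ι₁) ≈ₚ φ →
                pE ε₂ → pI ι₂ → (ε₂ ⨾ₚ ι₂) ≈ₚ φ →
                Σ (C ≡ C') λ p →
                  (subst (PHom A) p ε₁ ≈ₚ ε₂) × (subst (λ X → PHom X B) p ι₁ ≈ₚ ι₂)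
      punique {ε₁ = ε₁} {ε₂ = ε₂} Eε₁ Iι₁@(κ₁ , Iκ₁ , ι₁≅κ₁) c₁ Eε₂ Iι₂@(κ₂ , Iκ₂ , ι₂≅κ₂) c₂
        with factorisation-unique-≅ Eε₁ Iκ₁ Eε₂ Iκ₂
               (≅-trans (≅-sym (⨾ₚ-pI ε₁ Iι₁)) (≅-trans c₁ (≅-trans (≅-sym c₂) (⨾ₚ-pI ε₂ Iι₂))))
      ... | refl , ε₁≅ε₂ , κ₁≈κ₂ = refl , ε₁≅ε₂ , ≅-trans ι₁≅κ₁ (≅-trans (≈⇒≅ κ₁≈κ₂) (≅-sym ι₂≅κ₂))

      pInclusionSystem : SurjectionsStable Sign I E →
                         IsInclusionSystem PHom _≈ₚ_ idₚ _⨾ₚ_ pI pE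
      pInclusionSystem stable = record
        { I-resp = λ { φ≅ψ (ι , Iι , φ≅ι) → ι , Iι , ≅-trans (≅-sym φ≅ψ) φ≅ι }
        ; E-resp = ≅-E
        ; I-id = id , I-id , ≅-refl
        ; I-comp = λ {_} {_} {_} {φ} {ψ} → pI-comp {φ = φ} {ψ}
        ; E-id = E-id
        ; E-comp = λ {_} {_} {_} {φ} {ψ} → pE-comp stable {φ = φ} {ψ}
        ; I-thin = λ { (ι , Iι , φ≅ι) (κ , Iκ , ψ≅κ) →
                         ≅-trans φ≅ι (≅-trans (≈⇒≅ (I-thin Iι Iκ)) (≅-sym ψ≅κ)) }
        ; I-antisym = λ { (_ , Iι , _) (_ , Iκ , _) → I-antisym Iι Iκ }
        ; factor = pfactor
        ; unique = λ {_} {_} {_} {_} {φ} {ε₁} {ι₁} {ε₂} {ι₂} →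
                     punique {φ = φ} {ε₁ = ε₁} {ι₁ = ι₁} {ε₂ = ε₂} {ι₂ = ι₂}
        }

mainTheorem2 : ∀ {o ℓ e i j : Level} (Sign : Category o ℓ e)
    (I : ∀ {A B} → Category.Hom Sign A B → Set i)
    (E : ∀ {A B} → Category.Hom Sign A B → Set j)
    (IS : IsInclusionSystem (Category.Hom Sign) (Category._≈_ Sign) (Category.id Sign) (Category._⨾_ Sign) I E)
    → HasSemiInclusivePullbacks Sign I
    → (incPB : InclusivePullbacks Sign I)
    → SurjectionsStable Sign I E
    → IsInclusionSystem (Partial.PHom Sign I E IS incPB) (Partial._≈ₚ_ Sign I E IS incPB) (Partial.idₚ Sign I E IS incPB) (Partial._⨾ₚ_ Sign I E IS incPB) (Partial.pI Sign I E IS incPB) (Partial.pE Sign I E IS incPB)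
mainTheorem2 Sign I E IS _ incPB stable = pInclusionSystem Sign IS incPB stable
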